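{- Let $a\geq0$ and $b\geq1$ be integers and let $\Lambda(a,b,0,1)$ be the digraph with vertices $u_1,\dots,u_a,w_1,\dots,w_b,v$ whose arcs are $(u_i,u_{i'})$ for $i\neq i'$, $(u_i,w_j)$, $(w_j,v)$, $(v,w_j)$ and $(v,u_i)$ for all $i,j$. Then the Smith normal form of its distance matrix $D(\Lambda(a,b,0,1))$ is $I_{a+2}\oplus 2I_{b-2}\oplus[8a+2b]$ if $b\geq 2$, and is $I_{a+1}\oplus[4a+1]$ if $b=1$.
   Context: The distance matrix $D$ has $uv$-entry equal to the number of arcs of a shortest directed walk from $u$ to $v$. The Smith normal form of a square integer matrix $M$ is the unique diagonal matrix $\operatorname{diag}(f_1,\dots,f_r,0,\dots,0)$ with $f_i>0$, $f_i\mid f_{i+1}$, obtainable as $PMQ$ with $P,Q\in GL_n(\mathbb{Z})$. $I_m$ denotes the $m\times m$ identity matrix, $\oplus$ the block diagonal sum, and $[c]$ the $1\times1$ matrix with entry $c$. -}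

module Defs where

open import Data.Nat as ℕ using (ℕ; _+_; _<_; _≤_)
open import Data.Nat.Properties using (_<?_)
open import Data.Integer as ℤ using (ℤ; +_)
open import Data.Fin using (Fin; toℕ; splitAt; zero; suc)
open import Data.Sum using (_⊎_; inj₁; inj₂)
open import Data.Product using (Σ; _×_; _,_)
open import Data.Empty using (⊥)
open import Data.Unit using (⊤)
open import Relation.Binary.PropositionalEquality using (_≡_; _≢_)
open import Relation.Nullary using (yes; no)
open import Data.Integer.Divisibility using () renaming (_∣_ to _∣ℤ_)

Matrix : ℕ → Set
Matrix n = Fin n → Fin n → ℤ

sumFin : ∀ {n} → (Fin n → ℤ) → ℤ
sumFin {ℕ.zero}  f = + 0
sumFin {ℕ.suc n} f = f zero ℤ.+ sumFin (λ i → f (suc i))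

_⊗_ : ∀ {n} → Matrix n → Matrix n → Matrix n
(M ⊗ N) i j = sumFin (λ k → M i k ℤ.* N k j)

identity : ∀ {n} → Matrix n
identity i j with toℕ i ℕ.≟ toℕ j
... | yes _ = + 1
... | no  _ = + 0

diagM : ∀ {n} → (Fin n → ℤ) → Matrix n
diagM d i j with toℕ i ℕ.≟ toℕ j
... | yes _ = d i
... | no  _ = + 0

IsUnimodular : ∀ {n} → Matrix n → Set
IsUnimodular {n} P = Σ (Matrix n) λ P' →
  (∀ i j → (P ⊗ P') i j ≡ identity i j) × (∀ i j → (P' ⊗ P) i j ≡ identity i j)

_∼ℤ_ : ∀ {n} → Matrix n → Matrix n → Set
_∼ℤ_ {n} M N = Σ (Matrix n) λ P → Σ (Matrix n) λ Q →
  IsUnimodular P × IsUnimodular Q × (∀ i j → ((P ⊗ M) ⊗ Q) i j ≡ N i j)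

-- Smith normal form: diag(f_1,…,f_r,0,…,0) with f_i > 0, f_i ∣ f_{i+1}
-- (given as a list of diagonal entries d; r = number of nonzero entries)
IsSNFDiagonal : ∀ {n} → (Fin n → ℤ) → Set
IsSNFDiagonal {n} d =
  ∀ (i j : Fin n) → toℕ i < toℕ j →
    ((d i ≡ + 0) → d j ≡ + 0) ×
    ((d j ≢ + 0) → (ℤ.+0 ℤ.< d i) × (d i ∣ℤ d j))

HasSmithNormalForm : ∀ {n} → Matrix n → (Fin n → ℤ) → Set
HasSmithNormalForm M d = IsSNFDiagonal d × (M ∼ℤ diagM d)

Digraph : ℕ → Set₁
Digraph n = Fin n → Fin n → Set

data Walk {n} (G : Digraph n) : ℕ → Fin n → Fin n → Set where
  nil  : ∀ {u} → Walk G 0 u u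
  cons : ∀ {k u w v} → G u w → Walk G k w v → Walk G (ℕ.suc k) u v

IsDistanceMatrix : ∀ {n} → Digraph n → (Fin n → Fin n → ℕ) → Set
IsDistanceMatrix G D = ∀ u v →
  Walk G (D u v) u v × (∀ k → Walk G k u v → D u v ≤ k)

toℤMatrix : ∀ {n} → (Fin n → Fin n → ℕ) → Matrix n
toℤMatrix D i j = + (D i j)

-- The digraph Λ(a,b,0,1).  Vertex set Fin (a + (b + 1)):
-- the first a vertices are u_1..u_a, the next b are w_1..w_b, the last is v.

data Kind (a b : ℕ) : Set where
  U : Fin a → Kind a b
  W : Fin b → Kind a b
  V : Kind a b

kind : ∀ a b → Fin (a + (b + 1)) → Kind a b
kind a b x with splitAt a x
... | inj₁ i = U i
... | inj₂ y with splitAt b y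
...   | inj₁ j = W j
...   | inj₂ _ = V

ArcK : ∀ {a b} → Kind a b → Kind a b → Set
ArcK (U i) (U i') = i ≢ i'
ArcK (U i) (W j)  = ⊤
ArcK (W j) V      = ⊤
ArcK V     (W j)  = ⊤
ArcK V     (U i)  = ⊤
ArcK _     _      = ⊥

Λ : ∀ a b → Digraph (a + (b + 1))
Λ a b x y = ArcK (kind a b x) (kind a b y)

snfDiag≥2 : ∀ a b → Fin (a + (b + 1)) → ℤ
snfDiag≥2 a b i with toℕ i <? a + 2
... | yes _ = + 1
... | no _ with toℕ i <? a + b
...   | yes _ = + 2
...   | no _  = + (8 ℕ.* a + 2 ℕ.* b)

snfDiag1 : ∀ a → Fin (a + (1 + 1)) → ℤ
snfDiag1 a i with toℕ i <? a + 1
... | yes _ = + 1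
... | no _  = + (4 ℕ.* a + 1)

{-# OPTIONS --safe #-}
module Submission where

-- The vertices of Λ(a,b,0,1) fall into a few blocks (the u's, w₁, w₂, the
-- other w's and v; for b = 1 the u's, w and v), and any two vertices are at
-- distance at most 2, so D(x, y) depends only on the blocks of x and y and on
-- whether x = y.  Matrices of this shape are closed under multiplication, by a
-- product formula that is polynomial in the block sizes a and b − 2.  Hence
-- unimodular P and Q can be written down as block matrices with polynomial
-- entries, and P P⁻¹ = Q Q⁻¹ = I and P D Q = diag are verified uniformly in a
-- and b as polynomial identities, by normalisation.

open import Defs
open import Data.Bool using (Bool; true; false; T; if_then_else_; _∧_)
open import Data.Fin as Fin using (Fin; zero; suc; toℕ; _↑ˡ_; _↑ʳ_; splitAt; join)
open import Data.Fin.Patterns using (0F; 1F; 2F; 3F; 4F)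
import Data.Fin.Properties as Finₚ
open import Data.Integer as ℤ using (ℤ; +_; -_)
open import Data.Integer.Divisibility using (_∣_)
import Data.Integer.Properties as ℤₚ
open import Data.Integer.Solver using (module +-*-Solver)
open import Data.Maybe using (just; is-just)
open import Data.Nat as ℕ using (ℕ; zero; suc; _≤_; _<_; z≤n; s≤s)
import Data.Nat.Divisibility as ℕ∣
import Data.Nat.Properties as ℕₚ
open import Data.Product using (Σ; _×_; _,_; proj₁; proj₂; uncurry)
open import Data.Sum using (inj₁; inj₂)
open import Data.Unit using (⊤; tt)
open import Data.Vec using (Vec; []; _∷_; lookup)
open import Function using (_∘_)
open import Relation.Binary.PropositionalEquality
open import Relation.Nullary using (¬_; Dec; does; yes; no; _×-dec_; contradiction)
open import Relation.Nullary.Decidable using (T?; True; toWitness; map′)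
open +-*-Solver
  using (Polynomial; con; var; _:+_; _:*_; :-_; ⟦_⟧; normalise; _≟N_; ⟦_⟧N; ⟦_⟧N-cong; correct; solve; _:=_)

open ≡-Reasoning

module Summation where

  open import Data.Integer using (_+_; _*_)

  sumFin-cong : ∀ {n} {f g : Fin n → ℤ} → (∀ i → f i ≡ g i) → sumFin f ≡ sumFin g
  sumFin-cong {zero}  f≗g = refl
  sumFin-cong {suc n} f≗g = cong₂ _+_ (f≗g zero) (sumFin-cong (f≗g ∘ suc))

  sumFin-+ : ∀ {n} (f g : Fin n → ℤ) → sumFin (λ i → f i + g i) ≡ sumFin f + sumFin g
  sumFin-+ {zero}  f g = refl
  sumFin-+ {suc n} f g = begin
    (f zero + g zero) + sumFin (λ i → f (suc i) + g (suc i))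
      ≡⟨ cong (_+_ (f zero + g zero)) (sumFin-+ (f ∘ suc) (g ∘ suc)) ⟩
    (f zero + g zero) + (sumFin (f ∘ suc) + sumFin (g ∘ suc))
      ≡⟨ interchange (f zero) (g zero) _ _ ⟩
    (f zero + sumFin (f ∘ suc)) + (g zero + sumFin (g ∘ suc)) ∎
    where
    interchange : ∀ a b c d → (a + b) + (c + d) ≡ (a + c) + (b + d)
    interchange = solve 4 (λ a b c d → (a :+ b) :+ (c :+ d) := (a :+ c) :+ (b :+ d)) refl

  sumFin-*ˡ : ∀ {n} (c : ℤ) (f : Fin n → ℤ) → sumFin (λ i → c * f i) ≡ c * sumFin f
  sumFin-*ˡ {zero}  c f = sym (ℤₚ.*-zeroʳ c)
  sumFin-*ˡ {suc n} c f =
    trans (cong (_+_ (c * f zero)) (sumFin-*ˡ c (f ∘ suc))) (sym (ℤₚ.*-distribˡ-+ c (f zero) _))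

  sumFin-const : ∀ n (c : ℤ) → sumFin {n} (λ _ → c) ≡ + n * c
  sumFin-const zero    c = refl
  sumFin-const (suc n) c = begin
    c + sumFin {n} (λ _ → c) ≡⟨ cong (_+_ c) (sumFin-const n c) ⟩
    c + + n * c              ≡⟨ cong (_+ + n * c) (ℤₚ.*-identityˡ c) ⟨
    + 1 * c + + n * c        ≡⟨ ℤₚ.*-distribʳ-+ c (+ 1) (+ n) ⟨
    + suc n * c              ∎

  sumFin-single : ∀ {n} (y : Fin n) (f : Fin n → ℤ) → (∀ z → z ≢ y → f z ≡ + 0) → sumFin f ≡ f y
  sumFin-single {suc n} zero f vanish = begin
    f zero + sumFin (f ∘ suc)        ≡⟨ cong (_+_ (f zero)) (sumFin-cong λ z → vanish (suc z) λ ()) ⟩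
    f zero + sumFin {n} (λ _ → + 0)  ≡⟨ cong (_+_ (f zero)) (sumFin-const n (+ 0)) ⟩
    f zero + + n * + 0               ≡⟨ cong (_+_ (f zero)) (ℤₚ.*-zeroʳ (+ n)) ⟩
    f zero + + 0                     ≡⟨ ℤₚ.+-identityʳ (f zero) ⟩
    f zero                           ∎
  sumFin-single (suc y) f vanish = begin
    f zero + sumFin (f ∘ suc) ≡⟨ cong (_+ sumFin (f ∘ suc)) (vanish zero λ ()) ⟩
    + 0 + sumFin (f ∘ suc)    ≡⟨ ℤₚ.+-identityˡ _ ⟩
    sumFin (f ∘ suc)          ≡⟨ sumFin-single y (f ∘ suc) (λ z z≢y → vanish (suc z) (z≢y ∘ Finₚ.suc-injective)) ⟩
    f (suc y)                 ∎

  sumFin-↑ : ∀ m n (f : Fin (m ℕ.+ n) → ℤ) →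
    sumFin f ≡ sumFin (λ i → f (i ↑ˡ n)) + sumFin (λ j → f (m ↑ʳ j))
  sumFin-↑ zero    n f = sym (ℤₚ.+-identityˡ _)
  sumFin-↑ (suc m) n f =
    trans (cong (_+_ (f zero)) (sumFin-↑ m n (f ∘ suc))) (sym (ℤₚ.+-assoc (f zero) _ _))

  identity-≡ : ∀ {n} {x y : Fin n} → x ≡ y → identity x y ≡ + 1
  identity-≡ {x = x} {y} x≡y with toℕ x ℕ.≟ toℕ y
  ... | yes _ = refl
  ... | no  x≉y = contradiction (cong toℕ x≡y) x≉y

  identity-≢ : ∀ {n} {x y : Fin n} → x ≢ y → identity x y ≡ + 0
  identity-≢ {x = x} {y} x≢y with toℕ x ℕ.≟ toℕ y
  ... | yes x≈y = contradiction (Finₚ.toℕ-injective x≈y) x≢y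
  ... | no  _   = refl

  sumFin-*identity : ∀ {n} (f : Fin n → ℤ) y → sumFin (λ z → f z * identity z y) ≡ f y
  sumFin-*identity f y = begin
    sumFin (λ z → f z * identity z y)
      ≡⟨ sumFin-single y _ (λ z z≢y → trans (cong (f z *_) (identity-≢ z≢y)) (ℤₚ.*-zeroʳ (f z))) ⟩
    f y * identity y y  ≡⟨ cong (f y *_) (identity-≡ {x = y} refl) ⟩
    f y * + 1           ≡⟨ ℤₚ.*-identityʳ (f y) ⟩
    f y                 ∎

  sumFin-identity* : ∀ {n} (f : Fin n → ℤ) x → sumFin (λ z → identity x z * f z) ≡ f x
  sumFin-identity* f x = begin
    sumFin (λ z → identity x z * f z)
      ≡⟨ sumFin-single x _ (λ z z≢x → cong (_* f z) (identity-≢ (z≢x ∘ sym))) ⟩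
    identity x x * f x  ≡⟨ cong (_* f x) (identity-≡ {x = x} refl) ⟩
    + 1 * f x           ≡⟨ ℤₚ.*-identityˡ (f x) ⟩
    f x                 ∎

  ⊗-cong : ∀ {n} {M M′ N N′ : Matrix n} → (∀ i j → M i j ≡ M′ i j) → (∀ i j → N i j ≡ N′ i j) →
    ∀ i j → (M ⊗ N) i j ≡ (M′ ⊗ N′) i j
  ⊗-cong M≗M′ N≗N′ i j = sumFin-cong (λ k → cong₂ _*_ (M≗M′ i k) (N≗N′ k j))

open Summation

-- Opened only locally: once fromNat is in scope every numeral, including the
-- arity argument of solve, is elaborated through an instance.
module PolynomialLiterals where
  open import Agda.Builtin.FromNat public using (Number; fromNat)
  open import Agda.Builtin.FromNeg public using (Negative; fromNeg)

  open import Data.Nat.Literals using () renaming (number to ℕ-literals)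

  instance
    ℕ-number : Number ℕ
    ℕ-number = ℕ-literals

    Polynomial-number : ∀ {v} → Number (Polynomial v)
    Polynomial-number = record { Constraint = λ _ → ⊤ ; fromNat = λ n → con (+ n) }

    Polynomial-negative : ∀ {v} → Negative (Polynomial v)
    Polynomial-negative = record { Constraint = λ _ → ⊤ ; fromNeg = λ n → con (- + n) }

_≟ᴾ_ : ∀ {v} → Polynomial v → Polynomial v → Bool
p ≟ᴾ q = is-just (normalise p ≟N normalise q)

≟ᴾ-sound : ∀ {v} (p q : Polynomial v) → T (p ≟ᴾ q) → ∀ ρ → ⟦ p ⟧ ρ ≡ ⟦ q ⟧ ρ
≟ᴾ-sound p q _ ρ with normalise p ≟N normalise q
... | just p≈q = begin
  ⟦ p ⟧ ρ                  ≡⟨ correct p ρ ⟨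
  ⟦ normalise p ⟧N ρ       ≡⟨ ⟦ p≈q ⟧N-cong ρ ⟩
  ⟦ normalise q ⟧N ρ       ≡⟨ correct q ρ ⟩
  ⟦ q ⟧ ρ                  ∎

module BlockMatrices where

  open import Data.Integer using (_+_; _*_)

  ∑ᴾ : ∀ {v m} → (Fin m → Polynomial v) → Polynomial v
  ∑ᴾ {m = zero}  f = con (+ 0)
  ∑ᴾ {m = suc m} f = f zero :+ ∑ᴾ (f ∘ suc)

  ⟦∑ᴾ⟧ : ∀ {v m} (f : Fin m → Polynomial v) ρ → ⟦ ∑ᴾ f ⟧ ρ ≡ sumFin (λ i → ⟦ f i ⟧ ρ)
  ⟦∑ᴾ⟧ {m = zero}  f ρ = refl
  ⟦∑ᴾ⟧ {m = suc m} f ρ = cong (_+_ (⟦ f zero ⟧ ρ)) (⟦∑ᴾ⟧ (f ∘ suc) ρ)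

  -- Relative to a partition of the index set into m blocks, a block matrix
  -- has entry  off p q + diag p · δ x y  at (x, y) when x lies in block p
  -- and y in block q; entries are polynomials in v integer parameters.
  record BlockMatrix (v m : ℕ) : Set where
    constructor blocks
    field
      off  : Fin m → Fin m → Polynomial v
      diag : Fin m → Polynomial v

  open BlockMatrix

  fromRows : ∀ {v m} → Vec (Vec (Polynomial v) m) m → Vec (Polynomial v) m → BlockMatrix v m
  fromRows rows diagonal = blocks (λ p q → lookup (lookup rows p) q) (lookup diagonal)

  1ᴮ : ∀ {v m} → BlockMatrix v m
  1ᴮ = blocks (λ _ _ → con (+ 0)) (λ _ → con (+ 1))

  diagonalᴮ : ∀ {v m} → (Fin m → Polynomial v) → BlockMatrix v m
  diagonalᴮ = blocks (λ _ _ → con (+ 0))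

  zeroDiagonalᴮ : ∀ {v m} → (Fin m → Fin m → ℕ) → BlockMatrix v m
  zeroDiagonalᴮ f = blocks (λ p q → con (+ f p q)) (λ p → :- con (+ f p p))

  -- Multiplying out (α + β δ)(γ + ε δ): the α γ term sums over block k,
  -- which has `size k` elements.
  mulᴮ : ∀ {v m} → (Fin m → Polynomial v) → BlockMatrix v m → BlockMatrix v m → BlockMatrix v m
  mulᴮ size X Y = blocks
    (λ p q → ∑ᴾ (λ k → size k :* (off X p k :* off Y k q)) :+ off X p q :* diag Y q :+ diag X p :* off Y p q)
    (λ p → diag X p :* diag Y p)

  -- On a one-element block only off p p + diag p is determined by the matrix;
  -- moving diag p into off p p lets equal matrices be compared entrywise.
  absorbSingletons : ∀ {v m} → (Fin m → Bool) → BlockMatrix v m → BlockMatrix v m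
  absorbSingletons singleton X = blocks
    (λ p q → if singleton p ∧ does (p Fin.≟ q) then off X p q :+ diag X p else off X p q)
    (λ p → if singleton p then con (+ 0) else diag X p)

  record SameNormalForms {v m} (X Y : BlockMatrix v m) : Set where
    constructor same-normal-forms
    field
      off-≟  : ∀ p q → T (off X p q ≟ᴾ off Y p q)
      diag-≟ : ∀ p → T (diag X p ≟ᴾ diag Y p)

  sameNormalForms? : ∀ {v m} (X Y : BlockMatrix v m) → Dec (SameNormalForms X Y)
  sameNormalForms? X Y =
    map′ (uncurry same-normal-forms) (λ s → SameNormalForms.off-≟ s , SameNormalForms.diag-≟ s)
      (Finₚ.all? (λ p → Finₚ.all? (λ q → T? _)) ×-dec Finₚ.all? (λ p → T? _))

  module Blocked
    {v n m : ℕ} (ρ : Vec ℤ v) (block : Fin n → Fin m) (size : Fin m → Polynomial v)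
    (sumFin-block : ∀ g → sumFin (g ∘ block) ≡ sumFin (λ k → ⟦ size k ⟧ ρ * g k))
    (singleton : Fin m → Bool)
    (singleton-unique : ∀ x y → T (singleton (block x)) → block x ≡ block y → x ≡ y)
    where

    infixl 7 _·_
    infix 4 _≈ᴮ_

    _·_ : BlockMatrix v m → BlockMatrix v m → BlockMatrix v m
    _·_ = mulᴮ size

    ⟦_⟧ᴹ : BlockMatrix v m → Matrix n
    ⟦ X ⟧ᴹ x y = ⟦ off X (block x) (block y) ⟧ ρ + ⟦ diag X (block x) ⟧ ρ * identity x y

    ⟦·⟧ : ∀ X Y x y → (⟦ X ⟧ᴹ ⊗ ⟦ Y ⟧ᴹ) x y ≡ ⟦ X · Y ⟧ᴹ x y
    ⟦·⟧ X Y x y = begin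
      sumFin (λ z → (α z + β * δ x z) * (γ z + ε z * δ z y))
        ≡⟨ sumFin-cong (λ z → expand (α z) β (δ x z) (γ z) (ε z) (δ z y)) ⟩
      sumFin (λ z → t₁ z + (t₂ z + (t₃ z + t₄ z)))
        ≡⟨ trans (sumFin-+ t₁ _) (cong (_+_ (sumFin t₁))
             (trans (sumFin-+ t₂ _) (cong (_+_ (sumFin t₂)) (sumFin-+ t₃ t₄)))) ⟩
      sumFin t₁ + (sumFin t₂ + (sumFin t₃ + sumFin t₄))
        ≡⟨ cong₂ _+_ Σt₁ (cong₂ _+_ Σt₂ (cong₂ _+_ Σt₃ Σt₄)) ⟩
      Σαγ + (α y * ε y + (β * γ x + β * (ε x * δ x y)))
        ≡⟨ regroup Σαγ (α y * ε y) (β * γ x) β (ε x) (δ x y) ⟩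
      ⟦ X · Y ⟧ᴹ x y ∎
      where
      δ : Fin n → Fin n → ℤ
      δ = identity
      α γ : Fin n → ℤ
      α z = ⟦ off X (block x) (block z) ⟧ ρ
      γ z = ⟦ off Y (block z) (block y) ⟧ ρ
      ε : Fin n → ℤ
      ε z = ⟦ diag Y (block z) ⟧ ρ
      β : ℤ
      β = ⟦ diag X (block x) ⟧ ρ
      t₁ t₂ t₃ t₄ : Fin n → ℤ
      t₁ z = α z * γ z
      t₂ z = α z * ε z * δ z y
      t₃ z = β * (δ x z * γ z)
      t₄ z = β * (δ x z * (ε z * δ z y))
      Σαγ : ℤ
      Σαγ = ⟦ ∑ᴾ (λ k → size k :* (off X (block x) k :* off Y k (block y))) ⟧ ρ
      expand : ∀ a b d g e d′ → (a + b * d) * (g + e * d′) ≡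
        a * g + (a * e * d′ + (b * (d * g) + b * (d * (e * d′))))
      expand = solve 6 (λ a b d g e d′ → (a :+ b :* d) :* (g :+ e :* d′) :=
        a :* g :+ (a :* e :* d′ :+ (b :* (d :* g) :+ b :* (d :* (e :* d′))))) refl
      regroup : ∀ s p q b e d → s + (p + (q + b * (e * d))) ≡ s + p + q + b * e * d
      regroup = solve 6 (λ s p q b e d → s :+ (p :+ (q :+ b :* (e :* d))) := s :+ p :+ q :+ b :* e :* d) refl
      Σt₁ : sumFin t₁ ≡ Σαγ
      Σt₁ = trans (sumFin-block (λ k → ⟦ off X (block x) k ⟧ ρ * ⟦ off Y k (block y) ⟧ ρ))
                  (sym (⟦∑ᴾ⟧ (λ k → size k :* (off X (block x) k :* off Y k (block y))) ρ))
      Σt₂ : sumFin t₂ ≡ α y * ε y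
      Σt₂ = sumFin-*identity (λ z → α z * ε z) y
      Σt₃ : sumFin t₃ ≡ β * γ x
      Σt₃ = trans (sumFin-*ˡ β (λ z → δ x z * γ z)) (cong (β *_) (sumFin-identity* γ x))
      Σt₄ : sumFin t₄ ≡ β * (ε x * δ x y)
      Σt₄ = trans (sumFin-*ˡ β (λ z → δ x z * (ε z * δ z y))) (cong (β *_) (sumFin-identity* (λ z → ε z * δ z y) x))

    ⟦absorbSingletons⟧ : ∀ X x y → ⟦ X ⟧ᴹ x y ≡ ⟦ absorbSingletons singleton X ⟧ᴹ x y
    ⟦absorbSingletons⟧ X x y with singleton (block x) in single
    ... | false = refl
    ... | true with block x Fin.≟ block y
    ...   | yes same = begin
      α + β * identity x y   ≡⟨ cong (λ d → α + β * d) x≡y ⟩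
      α + β * + 1            ≡⟨ cong (_+_ α) (ℤₚ.*-identityʳ β) ⟩
      α + β                  ≡⟨ ℤₚ.+-identityʳ (α + β) ⟨
      α + β + + 0 * identity x y ∎
      where
      α β : ℤ
      α = ⟦ off X (block x) (block y) ⟧ ρ
      β = ⟦ diag X (block x) ⟧ ρ
      x≡y : identity x y ≡ + 1
      x≡y = identity-≡ (singleton-unique x y (subst T (sym single) tt) same)
    ...   | no different = begin
      α + β * identity x y   ≡⟨ cong (λ d → α + β * d) x≢y ⟩
      α + β * + 0            ≡⟨ cong (_+_ α) (ℤₚ.*-zeroʳ β) ⟩
      α + + 0                ≡⟨ cong (_+_ α) (cong (+ 0 *_) x≢y) ⟨
      α + + 0 * identity x y ∎
      where
      α β : ℤ
      α = ⟦ off X (block x) (block y) ⟧ ρ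
      β = ⟦ diag X (block x) ⟧ ρ
      x≢y : identity x y ≡ + 0
      x≢y = identity-≢ (different ∘ cong block)

    _≈ᴮ_ : BlockMatrix v m → BlockMatrix v m → Set
    X ≈ᴮ Y = SameNormalForms (absorbSingletons singleton X) (absorbSingletons singleton Y)

    by-normalisation : ∀ {X Y} {_ : True (sameNormalForms? (absorbSingletons singleton X) (absorbSingletons singleton Y))} →
      X ≈ᴮ Y
    by-normalisation {_} {_} {checked} = toWitness checked

    ⟦⟧-cong : ∀ {X Y} → X ≈ᴮ Y → ∀ x y → ⟦ X ⟧ᴹ x y ≡ ⟦ Y ⟧ᴹ x y
    ⟦⟧-cong {X} {Y} (same-normal-forms off-≟ diag-≟) x y = begin
      ⟦ X ⟧ᴹ x y   ≡⟨ ⟦absorbSingletons⟧ X x y ⟩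
      ⟦ X′ ⟧ᴹ x y  ≡⟨ cong₂ (λ s t → s + t * identity x y)
                         (≟ᴾ-sound (off X′ (block x) (block y)) (off Y′ (block x) (block y)) (off-≟ _ _) ρ)
                         (≟ᴾ-sound (diag X′ (block x)) (diag Y′ (block x)) (diag-≟ _) ρ) ⟩
      ⟦ Y′ ⟧ᴹ x y  ≡⟨ ⟦absorbSingletons⟧ Y x y ⟨
      ⟦ Y ⟧ᴹ x y   ∎
      where
      X′ Y′ : BlockMatrix v m
      X′ = absorbSingletons singleton X
      Y′ = absorbSingletons singleton Y

    ⟦1ᴮ⟧ : ∀ x y → ⟦ 1ᴮ ⟧ᴹ x y ≡ identity x y
    ⟦1ᴮ⟧ x y = trans (ℤₚ.+-identityˡ _) (ℤₚ.*-identityˡ (identity x y))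

    ⟦diagonalᴮ⟧ : ∀ (t : Fin m → Polynomial v) (d : Fin n → ℤ) → (∀ x → d x ≡ ⟦ t (block x) ⟧ ρ) →
      ∀ x y → diagM d x y ≡ ⟦ diagonalᴮ t ⟧ᴹ x y
    ⟦diagonalᴮ⟧ t d d≡t x y with toℕ x ℕ.≟ toℕ y
    ... | yes _ = sym (trans (ℤₚ.+-identityˡ _) (trans (ℤₚ.*-identityʳ _) (sym (d≡t x))))
    ... | no  _ = sym (trans (ℤₚ.+-identityˡ _) (ℤₚ.*-zeroʳ (⟦ t (block x) ⟧ ρ)))

    ⟦zeroDiagonalᴮ⟧ : ∀ (f : Fin m → Fin m → ℕ) (M : Matrix n) → (∀ x → M x x ≡ + 0) →
      (∀ x y → x ≢ y → M x y ≡ + f (block x) (block y)) → ∀ x y → M x y ≡ ⟦ zeroDiagonalᴮ f ⟧ᴹ x y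
    ⟦zeroDiagonalᴮ⟧ f M diagonal-zero off-diagonal x y with x Fin.≟ y
    ... | yes refl = begin
      M x x                                ≡⟨ diagonal-zero x ⟩
      + 0                                  ≡⟨ ℤₚ.+-inverseʳ (+ fₓ) ⟨
      + fₓ + - + fₓ                        ≡⟨ cong (_+_ (+ fₓ)) (ℤₚ.*-identityʳ (- + fₓ)) ⟨
      + fₓ + - + fₓ * + 1                  ≡⟨ cong (λ d → + fₓ + - + fₓ * d) (identity-≡ {x = x} refl) ⟨
      + fₓ + - + fₓ * identity x x ∎
      where
      fₓ : ℕ
      fₓ = f (block x) (block x)
    ... | no x≢y = begin
      M x y                         ≡⟨ off-diagonal x y x≢y ⟩
      + fₓᵧ                         ≡⟨ ℤₚ.+-identityʳ (+ fₓᵧ) ⟨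
      + fₓᵧ + + 0                   ≡⟨ cong (_+_ (+ fₓᵧ)) (ℤₚ.*-zeroʳ (- + fₓₓ)) ⟨
      + fₓᵧ + - + fₓₓ * + 0         ≡⟨ cong (λ d → + fₓᵧ + - + fₓₓ * d) (identity-≢ x≢y) ⟨
      + fₓᵧ + - + fₓₓ * identity x y ∎
      where
      fₓᵧ fₓₓ : ℕ
      fₓᵧ = f (block x) (block y)
      fₓₓ = f (block x) (block x)

    record Invertibleᴮ (X : BlockMatrix v m) : Set where
      field
        inverse  : BlockMatrix v m
        inverseʳ : X · inverse ≈ᴮ 1ᴮ
        inverseˡ : inverse · X ≈ᴮ 1ᴮ

    ⟦⟧-unimodular : ∀ {X} → Invertibleᴮ X → IsUnimodular ⟦ X ⟧ᴹ
    ⟦⟧-unimodular {X} X⁻¹ = ⟦ inverse ⟧ᴹ , is-identity X inverse inverseʳ , is-identity inverse X inverseˡ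
      where
      open Invertibleᴮ X⁻¹
      is-identity : ∀ Y Z → Y · Z ≈ᴮ 1ᴮ → ∀ x y → (⟦ Y ⟧ᴹ ⊗ ⟦ Z ⟧ᴹ) x y ≡ identity x y
      is-identity Y Z YZ≈1 x y = trans (⟦·⟧ Y Z x y) (trans (⟦⟧-cong YZ≈1 x y) (⟦1ᴮ⟧ x y))

    ∼ℤ-by-blocks : ∀ {M N : Matrix n} {P Q X Y} → Invertibleᴮ P → Invertibleᴮ Q → P · X · Q ≈ᴮ Y →
      (∀ x y → M x y ≡ ⟦ X ⟧ᴹ x y) → (∀ x y → N x y ≡ ⟦ Y ⟧ᴹ x y) → M ∼ℤ N
    ∼ℤ-by-blocks {M} {N} {P} {Q} {X} {Y} P⁻¹ Q⁻¹ PXQ≈Y M≡X N≡Y =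
      ⟦ P ⟧ᴹ , ⟦ Q ⟧ᴹ , ⟦⟧-unimodular P⁻¹ , ⟦⟧-unimodular Q⁻¹ , λ x y → begin
        ((⟦ P ⟧ᴹ ⊗ M) ⊗ ⟦ Q ⟧ᴹ) x y ≡⟨ ⊗-cong {N = ⟦ Q ⟧ᴹ} (⊗-cong {M = ⟦ P ⟧ᴹ} (λ _ _ → refl) M≡X) (λ _ _ → refl) x y ⟩
        ((⟦ P ⟧ᴹ ⊗ ⟦ X ⟧ᴹ) ⊗ ⟦ Q ⟧ᴹ) x y ≡⟨ ⊗-cong {N = ⟦ Q ⟧ᴹ} (⟦·⟧ P X) (λ _ _ → refl) x y ⟩
        (⟦ P · X ⟧ᴹ ⊗ ⟦ Q ⟧ᴹ) x y ≡⟨ ⟦·⟧ (P · X) Q x y ⟩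
        ⟦ P · X · Q ⟧ᴹ x y         ≡⟨ ⟦⟧-cong PXQ≈Y x y ⟩
        ⟦ Y ⟧ᴹ x y                 ≡⟨ N≡Y x y ⟨
        N x y                      ∎

open BlockMatrices

data Class : Set where
  u w v : Class

class : ∀ {a b} → Kind a b → Class
class (U _) = u
class (W _) = w
class V     = v

-- The distance between two distinct vertices of the given classes (there is
-- only one v, so the value for v v is immaterial).
classDistance : Class → Class → ℕ
classDistance u v = 2
classDistance w u = 2
classDistance w w = 2
classDistance v v = 0
classDistance _ _ = 1

classDistance≤2 : ∀ c c′ → classDistance c c′ ≤ 2
classDistance≤2 u u = s≤s z≤n
classDistance≤2 u w = s≤s z≤n
classDistance≤2 u v = ℕₚ.≤-refl
classDistance≤2 w u = ℕₚ.≤-refl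
classDistance≤2 w w = ℕₚ.≤-refl
classDistance≤2 w v = s≤s z≤n
classDistance≤2 v u = s≤s z≤n
classDistance≤2 v w = s≤s z≤n
classDistance≤2 v v = z≤n

arc⇒classDistance≤1 : ∀ {a b} (k l : Kind a b) → ArcK k l → classDistance (class k) (class l) ≤ 1
arc⇒classDistance≤1 (U _) (U _) _ = ℕₚ.≤-refl
arc⇒classDistance≤1 (U _) (W _) _ = ℕₚ.≤-refl
arc⇒classDistance≤1 (W _) V     _ = ℕₚ.≤-refl
arc⇒classDistance≤1 V     (U _) _ = ℕₚ.≤-refl
arc⇒classDistance≤1 V     (W _) _ = ℕₚ.≤-refl
arc⇒classDistance≤1 (U _) V     ()
arc⇒classDistance≤1 (W _) (U _) ()
arc⇒classDistance≤1 (W _) (W _) ()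
arc⇒classDistance≤1 V     V     ()

join-splitAt-≡ : ∀ m {n} {x : Fin (m ℕ.+ n)} {s} → splitAt m x ≡ s → join m n s ≡ x
join-splitAt-≡ m {n} {x} refl = Finₚ.join-splitAt m n x

module Λ-structure (a b : ℕ) where

  open import Data.Integer using (_+_; _*_)

  N : ℕ
  N = a ℕ.+ (b ℕ.+ 1)

  vertex : Kind a b → Fin N
  vertex (U i) = i ↑ˡ (b ℕ.+ 1)
  vertex (W j) = a ↑ʳ (j ↑ˡ 1)
  vertex V     = a ↑ʳ (b ↑ʳ zero)

  kind-vertex : ∀ k → kind a b (vertex k) ≡ k
  kind-vertex (U i) rewrite Finₚ.splitAt-↑ˡ a i (b ℕ.+ 1) = refl
  kind-vertex (W j) rewrite Finₚ.splitAt-↑ʳ a (b ℕ.+ 1) (j ↑ˡ 1) | Finₚ.splitAt-↑ˡ b j 1 = refl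
  kind-vertex V     rewrite Finₚ.splitAt-↑ʳ a (b ℕ.+ 1) (b ↑ʳ zero) | Finₚ.splitAt-↑ʳ b 1 zero = refl

  vertex-kind : ∀ x → vertex (kind a b x) ≡ x
  vertex-kind x with splitAt a x in split-x
  ... | inj₁ i = join-splitAt-≡ a split-x
  ... | inj₂ y with splitAt b y in split-y
  ...   | inj₁ j    = trans (cong (a ↑ʳ_) (join-splitAt-≡ b split-y)) (join-splitAt-≡ a split-x)
  ...   | inj₂ zero = trans (cong (a ↑ʳ_) (join-splitAt-≡ b split-y)) (join-splitAt-≡ a split-x)

  kind-injective : ∀ {x y} → kind a b x ≡ kind a b y → x ≡ y
  kind-injective {x} {y} same = begin
    x                    ≡⟨ vertex-kind x ⟨
    vertex (kind a b x)  ≡⟨ cong vertex same ⟩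
    vertex (kind a b y)  ≡⟨ vertex-kind y ⟩
    y                    ∎

  on-vertices : ∀ (f : Fin N → ℤ) (g : Kind a b → ℤ) → (∀ k → f (vertex k) ≡ g k) → ∀ x → f x ≡ g (kind a b x)
  on-vertices f g f≡g x = trans (cong f (sym (vertex-kind x))) (f≡g (kind a b x))

  sumFin-kind : ∀ (h : Kind a b → ℤ) → sumFin (h ∘ kind a b) ≡ sumFin (h ∘ U) + (sumFin (h ∘ W) + h V)
  sumFin-kind h = begin
    sumFin (h ∘ kind a b)
      ≡⟨ sumFin-↑ a (b ℕ.+ 1) _ ⟩
    sumFin (λ i → h′ (U i)) + sumFin (λ y → h (kind a b (a ↑ʳ y)))
      ≡⟨ cong (_+_ (sumFin (λ i → h′ (U i)))) (sumFin-↑ b 1 _) ⟩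
    sumFin (λ i → h′ (U i)) + (sumFin (λ j → h′ (W j)) + (h′ V + + 0))
      ≡⟨ cong₂ _+_ (sumFin-cong (λ i → cong h (kind-vertex (U i))))
           (cong₂ _+_ (sumFin-cong (λ j → cong h (kind-vertex (W j))))
             (trans (ℤₚ.+-identityʳ _) (cong h (kind-vertex V)))) ⟩
    sumFin (h ∘ U) + (sumFin (h ∘ W) + h V) ∎
    where
    h′ : Kind a b → ℤ
    h′ = h ∘ kind a b ∘ vertex

  position : Kind a b → ℕ
  position (U i) = toℕ i
  position (W j) = a ℕ.+ toℕ j
  position V     = a ℕ.+ b

  toℕ-vertex : ∀ k → toℕ (vertex k) ≡ position k
  toℕ-vertex (U i) = Finₚ.toℕ-↑ˡ i (b ℕ.+ 1)
  toℕ-vertex (W j) = trans (Finₚ.toℕ-↑ʳ a (j ↑ˡ 1)) (cong (a ℕ.+_) (Finₚ.toℕ-↑ˡ j 1))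
  toℕ-vertex V     = trans (Finₚ.toℕ-↑ʳ a (b ↑ʳ zero)) (cong (a ℕ.+_) (trans (Finₚ.toℕ-↑ʳ b zero) (ℕₚ.+-identityʳ b)))

  toℕ-vertex-< : ∀ k {t} → position k < t → toℕ (vertex k) < t
  toℕ-vertex-< k {t} = subst (_< t) (sym (toℕ-vertex k))

  distance : Fin N → Fin N → ℕ
  distance x y with x Fin.≟ y
  ... | yes _ = 0
  ... | no  _ = classDistance (class (kind a b x)) (class (kind a b y))

  distance-diagonal : ∀ x → distance x x ≡ 0
  distance-diagonal x with x Fin.≟ x
  ... | yes _   = refl
  ... | no  x≢x = contradiction refl x≢x

  distance-≢ : ∀ {x y} → x ≢ y → distance x y ≡ classDistance (class (kind a b x)) (class (kind a b y))
  distance-≢ {x} {y} x≢y with x Fin.≟ y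
  ... | yes x≡y = contradiction x≡y x≢y
  ... | no  _   = refl

  arc : ∀ k l → ArcK k l → Λ a b (vertex k) (vertex l)
  arc k l = subst₂ ArcK (sym (kind-vertex k)) (sym (kind-vertex l))

  edge : ∀ k l → ArcK k l → Walk (Λ a b) 1 (vertex k) (vertex l)
  edge k l k→l = cons (arc k l k→l) nil

  via : ∀ k m l → ArcK k m → ArcK m l → Walk (Λ a b) 2 (vertex k) (vertex l)
  via k m l k→m m→l = cons (arc k m k→m) (edge m l m→l)

  walk-kind : Fin b → ∀ k l → k ≢ l → Walk (Λ a b) (classDistance (class k) (class l)) (vertex k) (vertex l)
  walk-kind _  k@(U _) l@(U _) k≢l = edge k l (k≢l ∘ cong U)
  walk-kind _  k@(U _) l@(W _) _   = edge k l tt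
  walk-kind j₀ k@(U _) l@V     _   = via k (W j₀) l tt tt
  walk-kind _  k@(W _) l@(U _) _   = via k V l tt tt
  walk-kind _  k@(W _) l@(W _) _   = via k V l tt tt
  walk-kind _  k@(W _) l@V     _   = edge k l tt
  walk-kind _  k@V     l@(U _) _   = edge k l tt
  walk-kind _  k@V     l@(W _) _   = edge k l tt
  walk-kind _  V       V       k≢l = contradiction refl k≢l

  distance-walk : Fin b → ∀ x y → Walk (Λ a b) (distance x y) x y
  distance-walk j₀ x y with x Fin.≟ y
  ... | yes refl = nil
  ... | no  x≢y  = subst₂ (Walk (Λ a b) _) (vertex-kind x) (vertex-kind y)
                     (walk-kind j₀ (kind a b x) (kind a b y) (x≢y ∘ kind-injective))

  classDistance≤length : ∀ {x y k} → x ≢ y → Walk (Λ a b) k x y →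
    classDistance (class (kind a b x)) (class (kind a b y)) ≤ k
  classDistance≤length x≢y nil = contradiction refl x≢y
  classDistance≤length {x} {y} _ (cons x→y nil) = arc⇒classDistance≤1 (kind a b x) (kind a b y) x→y
  classDistance≤length _ (cons _ (cons _ _)) = ℕₚ.≤-trans (classDistance≤2 _ _) (s≤s (s≤s z≤n))

  distance-minimal : ∀ {x y k} → Walk (Λ a b) k x y → distance x y ≤ k
  distance-minimal {x} {y} walk with x Fin.≟ y
  ... | yes _   = z≤n
  ... | no  x≢y = classDistance≤length x≢y walk

  distance-isDistanceMatrix : Fin b → IsDistanceMatrix (Λ a b) distance
  distance-isDistanceMatrix j₀ x y = distance-walk j₀ x y , λ _ → distance-minimal

  distance-unique : Fin b → ∀ D → IsDistanceMatrix (Λ a b) D → ∀ x y → D x y ≡ distance x y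
  distance-unique j₀ D isD x y =
    ℕₚ.≤-antisym (proj₂ (isD x y) _ (distance-walk j₀ x y)) (distance-minimal (proj₁ (isD x y)))

  distance-by-blocks : ∀ {m} (blockOf : Kind a b → Fin m) (classOf : Fin m → Class) →
    (∀ k → classOf (blockOf k) ≡ class k) → ∀ {x y} → x ≢ y →
    distance x y ≡ classDistance (classOf (blockOf (kind a b x))) (classOf (blockOf (kind a b y)))
  distance-by-blocks blockOf classOf classOf-blockOf {x} {y} x≢y =
    trans (distance-≢ x≢y) (sym (cong₂ classDistance (classOf-blockOf (kind a b x)) (classOf-blockOf (kind a b y))))

  singleton-unique-by-member : ∀ {m} (blockOf : Kind a b → Fin m) (singleton : Fin m → Bool)
    (member : Fin m → Kind a b) → (∀ k → T (singleton (blockOf k)) → k ≡ member (blockOf k)) →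
    ∀ x y → T (singleton (blockOf (kind a b x))) → blockOf (kind a b x) ≡ blockOf (kind a b y) → x ≡ y
  singleton-unique-by-member blockOf singleton member is-member x y single same = kind-injective (begin
    kind a b x                     ≡⟨ is-member (kind a b x) single ⟩
    member (blockOf (kind a b x))  ≡⟨ cong member same ⟩
    member (blockOf (kind a b y))  ≡⟨ is-member (kind a b y) (subst (T ∘ singleton) same single) ⟨
    kind a b y                     ∎)

  module Partition
    {v m : ℕ} (j₀ : Fin b) (blockOf : Kind a b → Fin m)
    (classOf : Fin m → Class) (classOf-blockOf : ∀ k → classOf (blockOf k) ≡ class k)
    (singleton : Fin m → Bool) (member : Fin m → Kind a b)
    (member-blockOf : ∀ k → T (singleton (blockOf k)) → k ≡ member (blockOf k))
    (ρ : Vec ℤ v) (size : Fin m → Polynomial v)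
    (sumFin-block : ∀ g → sumFin (g ∘ blockOf ∘ kind a b) ≡ sumFin (λ k → ⟦ size k ⟧ ρ * g k))
    where

    open Blocked ρ (blockOf ∘ kind a b) size sumFin-block singleton
      (singleton-unique-by-member blockOf singleton member member-blockOf) public

    blockDistance : Fin m → Fin m → ℕ
    blockDistance p q = classDistance (classOf p) (classOf q)

    distanceᴮ : BlockMatrix v m
    distanceᴮ = zeroDiagonalᴮ blockDistance

    distanceMatrix≡distanceᴮ : ∀ D → IsDistanceMatrix (Λ a b) D → ∀ x y → toℤMatrix D x y ≡ ⟦ distanceᴮ ⟧ᴹ x y
    distanceMatrix≡distanceᴮ D isD = ⟦zeroDiagonalᴮ⟧ blockDistance (toℤMatrix D)
      (λ x → cong +_ (trans (distance-unique j₀ D isD x x) (distance-diagonal x)))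
      (λ x y x≢y → cong +_ (trans (distance-unique j₀ D isD x y)
                                   (distance-by-blocks blockOf classOf classOf-blockOf x≢y)))

    hasSmithNormalForm : ∀ {d P Q t} → IsSNFDiagonal d →
      Invertibleᴮ P → Invertibleᴮ Q → P · distanceᴮ · Q ≈ᴮ diagonalᴮ t →
      (∀ k → d (vertex k) ≡ ⟦ t (blockOf k) ⟧ ρ) →
      ∀ D → IsDistanceMatrix (Λ a b) D → HasSmithNormalForm (toℤMatrix D) d
    hasSmithNormalForm {d} {t = t} isSNF P-invertible Q-invertible PDQ≈t d≡t D isD =
      isSNF ,
      ∼ℤ-by-blocks P-invertible Q-invertible PDQ≈t (distanceMatrix≡distanceᴮ D isD)
        (⟦diagonalᴮ⟧ t d (on-vertices d (λ k → ⟦ t (blockOf k) ⟧ ρ) d≡t))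

positive-chain⇒IsSNFDiagonal : ∀ {n} {d : Fin n → ℤ} → (∀ i → + 0 ℤ.< d i) →
  (∀ i j → toℕ i < toℕ j → d i ∣ d j) → IsSNFDiagonal d
positive-chain⇒IsSNFDiagonal {d = d} positive divides i j i<j =
  (λ dᵢ≡0 → contradiction (subst (+ 0 ℤ.<_) dᵢ≡0 (positive i)) (ℤₚ.<-irrefl refl)) ,
  (λ _ → positive i , divides i j i<j)

toℕ<toℕ⇒<a+b : ∀ a b {i j : Fin (a ℕ.+ (b ℕ.+ 1))} → toℕ i < toℕ j → toℕ i < a ℕ.+ b
toℕ<toℕ⇒<a+b a b {j = j} i<j = ℕₚ.<-≤-trans i<j (ℕₚ.m<1+n⇒m≤n (subst (toℕ j <_) size≡1+a+b (Finₚ.toℕ<n j)))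
  where
  size≡1+a+b : a ℕ.+ (b ℕ.+ 1) ≡ suc (a ℕ.+ b)
  size≡1+a+b = trans (cong (a ℕ.+_) (ℕₚ.+-comm b 1)) (ℕₚ.+-suc a b)

snfDiag≥2-head : ∀ a b {i} → toℕ i < a ℕ.+ 2 → snfDiag≥2 a b i ≡ + 1
snfDiag≥2-head a b {i} i< with toℕ i ℕₚ.<? a ℕ.+ 2
... | yes _  = refl
... | no  i≮ = contradiction i< i≮

snfDiag≥2-middle : ∀ a b {i} → ¬ toℕ i < a ℕ.+ 2 → toℕ i < a ℕ.+ b → snfDiag≥2 a b i ≡ + 2
snfDiag≥2-middle a b {i} i≮ i< with toℕ i ℕₚ.<? a ℕ.+ 2
... | yes i<′ = contradiction i<′ i≮
... | no  _ with toℕ i ℕₚ.<? a ℕ.+ b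
...   | yes _   = refl
...   | no  i≮′ = contradiction i< i≮′

snfDiag≥2-last : ∀ a b {i} → 2 ≤ b → ¬ toℕ i < a ℕ.+ b → snfDiag≥2 a b i ≡ + (8 ℕ.* a ℕ.+ 2 ℕ.* b)
snfDiag≥2-last a b {i} 2≤b i≮ with toℕ i ℕₚ.<? a ℕ.+ 2
... | yes i< = contradiction (ℕₚ.<-≤-trans i< (ℕₚ.+-monoʳ-≤ a 2≤b)) i≮
... | no  _ with toℕ i ℕₚ.<? a ℕ.+ b
...   | yes i<′ = contradiction i<′ i≮
...   | no  _   = refl

snfDiag≥2-isSNF : ∀ a b → 2 ≤ b → IsSNFDiagonal (snfDiag≥2 a b)
snfDiag≥2-isSNF a b 2≤b = positive-chain⇒IsSNFDiagonal positive divides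
  where
  positive : ∀ i → + 0 ℤ.< snfDiag≥2 a b i
  positive i with toℕ i ℕₚ.<? a ℕ.+ 2
  ... | yes _ = ℤ.+<+ (s≤s z≤n)
  ... | no  _ with toℕ i ℕₚ.<? a ℕ.+ b
  ...   | yes _ = ℤ.+<+ (s≤s z≤n)
  ...   | no  _ = ℤ.+<+ (ℕₚ.<-≤-trans (s≤s z≤n) (ℕₚ.≤-trans (ℕₚ.*-monoʳ-≤ 2 2≤b) (ℕₚ.m≤n+m (2 ℕ.* b) (8 ℕ.* a))))
  divides : ∀ i j → toℕ i < toℕ j → snfDiag≥2 a b i ∣ snfDiag≥2 a b j
  divides i j i<j with toℕ i ℕₚ.<? a ℕ.+ 2
  ... | yes _  = ℕ∣.1∣ _
  ... | no  i≮ with toℕ i ℕₚ.<? a ℕ.+ b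
  ...   | no  i≮′ = contradiction (toℕ<toℕ⇒<a+b a b i<j) i≮′
  ...   | yes _ with toℕ j ℕₚ.<? a ℕ.+ 2
  ...     | yes j< = contradiction (ℕₚ.<-trans i<j j<) i≮
  ...     | no  _ with toℕ j ℕₚ.<? a ℕ.+ b
  ...       | yes _ = ℕ∣.∣-refl
  ...       | no  _ = ℕ∣.∣m∣n⇒∣m+n (ℕ∣.∣-trans (ℕ∣.divides 4 refl) (ℕ∣.m∣m*n a)) (ℕ∣.m∣m*n b)

snfDiag1-head : ∀ a {i} → toℕ i < a ℕ.+ 1 → snfDiag1 a i ≡ + 1
snfDiag1-head a {i} i< with toℕ i ℕₚ.<? a ℕ.+ 1
... | yes _  = refl
... | no  i≮ = contradiction i< i≮

snfDiag1-last : ∀ a {i} → ¬ toℕ i < a ℕ.+ 1 → snfDiag1 a i ≡ + (4 ℕ.* a ℕ.+ 1)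
snfDiag1-last a {i} i≮ with toℕ i ℕₚ.<? a ℕ.+ 1
... | yes i< = contradiction i< i≮
... | no  _  = refl

snfDiag1-isSNF : ∀ a → IsSNFDiagonal (snfDiag1 a)
snfDiag1-isSNF a = positive-chain⇒IsSNFDiagonal positive divides
  where
  positive : ∀ i → + 0 ℤ.< snfDiag1 a i
  positive i with toℕ i ℕₚ.<? a ℕ.+ 1
  ... | yes _ = ℤ.+<+ (s≤s z≤n)
  ... | no  _ = ℤ.+<+ (ℕₚ.m≤n+m 1 (4 ℕ.* a))
  divides : ∀ i j → toℕ i < toℕ j → snfDiag1 a i ∣ snfDiag1 a j
  divides i j i<j = subst (_∣ snfDiag1 a j) (sym (snfDiag1-head a (toℕ<toℕ⇒<a+b a 1 i<j))) (ℕ∣.1∣ _)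

module AtLeastTwoW (a b′ : ℕ) where

  open import Data.Integer using (_+_; _*_)

  b : ℕ
  b = 2 ℕ.+ b′

  open Λ-structure a b

  blockOf : Kind a b → Fin 5
  blockOf (U _)             = 0F
  blockOf (W 0F)            = 1F
  blockOf (W 1F)            = 2F
  blockOf (W (suc (suc _))) = 3F
  blockOf V                 = 4F

  classOf : Fin 5 → Class
  classOf = lookup (u ∷ w ∷ w ∷ w ∷ v ∷ [])

  classOf-blockOf : ∀ k → classOf (blockOf k) ≡ class k
  classOf-blockOf (U _)             = refl
  classOf-blockOf (W 0F)            = refl
  classOf-blockOf (W 1F)            = refl
  classOf-blockOf (W (suc (suc _))) = refl
  classOf-blockOf V                 = refl

  singleton : Fin 5 → Bool
  singleton = lookup (false ∷ true ∷ true ∷ false ∷ true ∷ [])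

  member : Fin 5 → Kind a b
  member 1F = W 0F
  member 2F = W 1F
  member _  = V

  member-blockOf : ∀ k → T (singleton (blockOf k)) → k ≡ member (blockOf k)
  member-blockOf (W 0F) _ = refl
  member-blockOf (W 1F) _ = refl
  member-blockOf V      _ = refl

  ρ : Vec ℤ 2
  ρ = + a ∷ + b′ ∷ []

  module Matrices where
    open PolynomialLiterals

    A B : Polynomial 2
    A = var 0F
    B = var 1F

    size : Fin 5 → Polynomial 2
    size = lookup (A ∷ 1 ∷ 1 ∷ B ∷ 1 ∷ [])

    P P⁻¹ Q Q⁻¹ : BlockMatrix 2 5
    P = fromRows
      ( (0 ∷ 0                ∷ 0 ∷ 0 ∷ 1           ∷ [])
      ∷ (0 ∷ 0                ∷ 0 ∷ 0 ∷ -2          ∷ [])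
      ∷ (1 ∷ -2 :* A          ∷ 0 ∷ 0 ∷ 1 :+ 3 :* A ∷ [])
      ∷ (0 ∷ 1                ∷ 0 ∷ 0 ∷ 0           ∷ [])
      ∷ (2 ∷ -1 :+ -1 :* B :+ -4 :* A ∷ 1 ∷ 1 ∷ 2 :+ 6 :* A ∷ [])
      ∷ [])
      (-1 ∷ 1 ∷ 0 ∷ -1 ∷ 0 ∷ [])
    P⁻¹ = fromRows
      ( (1 ∷ 2 :* A     ∷ 1 ∷ 0 ∷ 0 ∷ [])
      ∷ (2 ∷ 4 :* A     ∷ 2 ∷ 0 ∷ 0 ∷ [])
      ∷ (2 ∷ 1 :+ 4 :* A ∷ 0 ∷ 1 ∷ 1 ∷ [])
      ∷ (2 ∷ 1 :+ 4 :* A ∷ 2 ∷ 0 ∷ 0 ∷ [])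
      ∷ (1 ∷ 2 :* A     ∷ 1 ∷ 0 ∷ 0 ∷ [])
      ∷ [])
      (-1 ∷ 1 ∷ 0 ∷ -1 ∷ 0 ∷ [])
    Q = fromRows
      ( (0 ∷ 2 ∷ 0 ∷ 0  ∷ 4 ∷ [])
      ∷ (0 ∷ 0 ∷ 0 ∷ 0  ∷ 1 ∷ [])
      ∷ (0 ∷ 0 ∷ 0 ∷ -1 ∷ -1 :+ -1 :* B :+ -4 :* A ∷ [])
      ∷ (0 ∷ 0 ∷ 0 ∷ 0  ∷ 1 ∷ [])
      ∷ (0 ∷ 1 ∷ 0 ∷ 0  ∷ 2 ∷ [])
      ∷ [])
      (1 ∷ 0 ∷ 1 ∷ 1 ∷ 0 ∷ [])
    Q⁻¹ = fromRows
      ( (0 ∷ 0           ∷ 0 ∷ 0 ∷ -2 ∷ [])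
      ∷ (0 ∷ -2          ∷ 0 ∷ 0 ∷ 1  ∷ [])
      ∷ (0 ∷ 1 :+ 4 :* A ∷ 0 ∷ 1 ∷ 0  ∷ [])
      ∷ (0 ∷ -1          ∷ 0 ∷ 0 ∷ 0  ∷ [])
      ∷ (0 ∷ 1           ∷ 0 ∷ 0 ∷ 0  ∷ [])
      ∷ [])
      (1 ∷ 0 ∷ 1 ∷ 1 ∷ 0 ∷ [])

    target : Fin 5 → Polynomial 2
    target = lookup (1 ∷ 1 ∷ 1 ∷ 2 ∷ 8 :* A :+ 2 :* (2 :+ B) ∷ [])
  open Matrices

  sumFin-block : ∀ g → sumFin (g ∘ blockOf ∘ kind a b) ≡ sumFin (λ k → ⟦ size k ⟧ ρ * g k)
  sumFin-block g = begin
    sumFin (g ∘ blockOf ∘ kind a b)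
      ≡⟨ sumFin-kind (g ∘ blockOf) ⟩
    sumFin {a} (λ _ → g 0F) + ((g 1F + (g 2F + sumFin {b′} (λ _ → g 3F))) + g 4F)
      ≡⟨ cong₂ (λ s t → s + ((g 1F + (g 2F + t)) + g 4F)) (sumFin-const a (g 0F)) (sumFin-const b′ (g 3F)) ⟩
    + a * g 0F + ((g 1F + (g 2F + + b′ * g 3F)) + g 4F)
      ≡⟨ regroup (+ a) (+ b′) (g 0F) (g 1F) (g 2F) (g 3F) (g 4F) ⟩
    sumFin (λ k → ⟦ size k ⟧ ρ * g k) ∎
    where
    regroup : ∀ a b g₀ g₁ g₂ g₃ g₄ → a * g₀ + ((g₁ + (g₂ + b * g₃)) + g₄) ≡
      a * g₀ + (+ 1 * g₁ + (+ 1 * g₂ + (b * g₃ + (+ 1 * g₄ + + 0))))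
    regroup = solve 7 (λ a b g₀ g₁ g₂ g₃ g₄ →
      a :* g₀ :+ ((g₁ :+ (g₂ :+ b :* g₃)) :+ g₄) :=
      a :* g₀ :+ (con (+ 1) :* g₁ :+ (con (+ 1) :* g₂ :+ (b :* g₃ :+ (con (+ 1) :* g₄ :+ con (+ 0)))))) refl

  open Partition 0F blockOf classOf classOf-blockOf singleton member member-blockOf ρ size sumFin-block

  P-invertible : Invertibleᴮ P
  P-invertible = record { inverse = P⁻¹ ; inverseʳ = by-normalisation ; inverseˡ = by-normalisation }

  Q-invertible : Invertibleᴮ Q
  Q-invertible = record { inverse = Q⁻¹ ; inverseʳ = by-normalisation ; inverseˡ = by-normalisation }

  PDQ≈target : P · distanceᴮ · Q ≈ᴮ diagonalᴮ target
  PDQ≈target = by-normalisation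

  snfDiag≥2-vertex : ∀ k → snfDiag≥2 a b (vertex k) ≡ ⟦ target (blockOf k) ⟧ ρ
  snfDiag≥2-vertex (U i) = snfDiag≥2-head a b (toℕ-vertex-< (U i) (ℕₚ.<-≤-trans (Finₚ.toℕ<n i) (ℕₚ.m≤m+n a 2)))
  snfDiag≥2-vertex (W 0F) = snfDiag≥2-head a b (toℕ-vertex-< (W 0F) (ℕₚ.+-monoʳ-< a (s≤s z≤n)))
  snfDiag≥2-vertex (W 1F) = snfDiag≥2-head a b (toℕ-vertex-< (W 1F) (ℕₚ.+-monoʳ-< a (s≤s (s≤s z≤n))))
  snfDiag≥2-vertex (W (suc (suc j))) = snfDiag≥2-middle a b
    (λ lt → past-w₂ (ℕₚ.+-cancelˡ-< a _ _ (subst (_< a ℕ.+ 2) (toℕ-vertex (W (suc (suc j)))) lt)))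
    (toℕ-vertex-< (W (suc (suc j))) (ℕₚ.+-monoʳ-< a (s≤s (s≤s (Finₚ.toℕ<n j)))))
    where
    past-w₂ : ¬ suc (suc (toℕ j)) < 2
    past-w₂ (s≤s (s≤s ()))
  snfDiag≥2-vertex V = begin
    snfDiag≥2 a b (vertex V)         ≡⟨ snfDiag≥2-last a b (s≤s (s≤s z≤n))
                                          (λ lt → ℕₚ.n≮n _ (subst (_< a ℕ.+ b) (toℕ-vertex V) lt)) ⟩
    + (8 ℕ.* a ℕ.+ 2 ℕ.* b)          ≡⟨ ℤₚ.pos-+ (8 ℕ.* a) (2 ℕ.* b) ⟩
    + (8 ℕ.* a) + + (2 ℕ.* b)        ≡⟨ cong₂ _+_ (ℤₚ.pos-* 8 a) (trans (ℤₚ.pos-* 2 b) (cong (+ 2 *_) (ℤₚ.pos-+ 2 b′))) ⟩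
    + 8 * + a + + 2 * (+ 2 + + b′)   ∎

  smithNormalForm : ∀ D → IsDistanceMatrix (Λ a b) D → HasSmithNormalForm (toℤMatrix D) (snfDiag≥2 a b)
  smithNormalForm = hasSmithNormalForm (snfDiag≥2-isSNF a b (s≤s (s≤s z≤n))) P-invertible Q-invertible PDQ≈target snfDiag≥2-vertex

module OneW (a : ℕ) where

  open import Data.Integer using (_+_; _*_)

  open Λ-structure a 1

  blockOf : Kind a 1 → Fin 3
  blockOf (U _) = 0F
  blockOf (W _) = 1F
  blockOf V     = 2F

  classOf : Fin 3 → Class
  classOf = lookup (u ∷ w ∷ v ∷ [])

  classOf-blockOf : ∀ k → classOf (blockOf k) ≡ class k
  classOf-blockOf (U _) = refl
  classOf-blockOf (W _) = refl
  classOf-blockOf V     = refl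

  singleton : Fin 3 → Bool
  singleton = lookup (false ∷ true ∷ true ∷ [])

  member : Fin 3 → Kind a 1
  member 1F = W 0F
  member _  = V

  member-blockOf : ∀ k → T (singleton (blockOf k)) → k ≡ member (blockOf k)
  member-blockOf (W 0F) _ = refl
  member-blockOf V      _ = refl

  ρ : Vec ℤ 1
  ρ = + a ∷ []

  module Matrices where
    open PolynomialLiterals

    A : Polynomial 1
    A = var 0F

    size : Fin 3 → Polynomial 1
    size = lookup (A ∷ 1 ∷ 1 ∷ [])

    P P⁻¹ Q Q⁻¹ : BlockMatrix 1 3
    P = fromRows
      ( (0 ∷ 0 ∷ 1      ∷ [])
      ∷ (1 ∷ 0 ∷ 1 :+ -1 :* A ∷ [])
      ∷ (2 ∷ 1 ∷ -2 :* A ∷ [])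
      ∷ [])
      (-1 ∷ 0 ∷ 0 ∷ [])
    P⁻¹ = fromRows
      ( (1 ∷ 1 ∷ 0 ∷ [])
      ∷ (2 ∷ 0 ∷ 1 ∷ [])
      ∷ (1 ∷ 1 ∷ 0 ∷ [])
      ∷ [])
      (-1 ∷ 0 ∷ 0 ∷ [])
    Q = fromRows
      ( (0 ∷ 0 ∷ 2       ∷ [])
      ∷ (0 ∷ 0 ∷ -2 :* A ∷ [])
      ∷ (0 ∷ 0 ∷ 0       ∷ [])
      ∷ [])
      (1 ∷ 1 ∷ 1 ∷ [])
    Q⁻¹ = fromRows
      ( (0 ∷ 0 ∷ -2     ∷ [])
      ∷ (0 ∷ 0 ∷ 2 :* A ∷ [])
      ∷ (0 ∷ 0 ∷ 0      ∷ [])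
      ∷ [])
      (1 ∷ 1 ∷ 1 ∷ [])

    target : Fin 3 → Polynomial 1
    target = lookup (1 ∷ 1 ∷ 4 :* A :+ 1 ∷ [])

  open Matrices

  sumFin-block : ∀ g → sumFin (g ∘ blockOf ∘ kind a 1) ≡ sumFin (λ k → ⟦ size k ⟧ ρ * g k)
  sumFin-block g = begin
    sumFin (g ∘ blockOf ∘ kind a 1)
      ≡⟨ sumFin-kind (g ∘ blockOf) ⟩
    sumFin {a} (λ _ → g 0F) + ((g 1F + + 0) + g 2F)
      ≡⟨ cong (λ s → s + ((g 1F + + 0) + g 2F)) (sumFin-const a (g 0F)) ⟩
    + a * g 0F + ((g 1F + + 0) + g 2F)
      ≡⟨ regroup (+ a) (g 0F) (g 1F) (g 2F) ⟩
    sumFin (λ k → ⟦ size k ⟧ ρ * g k) ∎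
    where
    regroup : ∀ a g₀ g₁ g₂ → a * g₀ + ((g₁ + + 0) + g₂) ≡ a * g₀ + (+ 1 * g₁ + (+ 1 * g₂ + + 0))
    regroup = solve 4 (λ a g₀ g₁ g₂ →
      a :* g₀ :+ ((g₁ :+ con (+ 0)) :+ g₂) :=
      a :* g₀ :+ (con (+ 1) :* g₁ :+ (con (+ 1) :* g₂ :+ con (+ 0)))) refl

  open Partition 0F blockOf classOf classOf-blockOf singleton member member-blockOf ρ size sumFin-block

  P-invertible : Invertibleᴮ P
  P-invertible = record { inverse = P⁻¹ ; inverseʳ = by-normalisation ; inverseˡ = by-normalisation }

  Q-invertible : Invertibleᴮ Q
  Q-invertible = record { inverse = Q⁻¹ ; inverseʳ = by-normalisation ; inverseˡ = by-normalisation }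

  PDQ≈target : P · distanceᴮ · Q ≈ᴮ diagonalᴮ target
  PDQ≈target = by-normalisation

  snfDiag1-vertex : ∀ k → snfDiag1 a (vertex k) ≡ ⟦ target (blockOf k) ⟧ ρ
  snfDiag1-vertex (U i)  = snfDiag1-head a (toℕ-vertex-< (U i) (ℕₚ.<-≤-trans (Finₚ.toℕ<n i) (ℕₚ.m≤m+n a 1)))
  snfDiag1-vertex (W 0F) = snfDiag1-head a (toℕ-vertex-< (W 0F) (ℕₚ.+-monoʳ-< a (s≤s z≤n)))
  snfDiag1-vertex V      = begin
    snfDiag1 a (vertex V)  ≡⟨ snfDiag1-last a (λ lt → ℕₚ.n≮n _ (subst (_< a ℕ.+ 1) (toℕ-vertex V) lt)) ⟩
    + (4 ℕ.* a ℕ.+ 1)      ≡⟨ ℤₚ.pos-+ (4 ℕ.* a) 1 ⟩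
    + (4 ℕ.* a) + + 1      ≡⟨ cong (_+ + 1) (ℤₚ.pos-* 4 a) ⟩
    + 4 * + a + + 1        ∎

  smithNormalForm : ∀ D → IsDistanceMatrix (Λ a 1) D → HasSmithNormalForm (toℤMatrix D) (snfDiag1 a)
  smithNormalForm = hasSmithNormalForm (snfDiag1-isSNF a) P-invertible Q-invertible PDQ≈target snfDiag1-vertex

open import Data.Nat using (_+_)

theorem19 :
    -- the distance matrix of Λ(a,b,0,1) exists (b ≥ 1)
    (∀ (a b : ℕ) → 1 ≤ b →
      Σ (Fin (a + (b + 1)) → Fin (a + (b + 1)) → ℕ) (IsDistanceMatrix (Λ a b)))
    -- b ≥ 2 : SNF is I_{a+2} ⊕ 2 I_{b-2} ⊕ [8a+2b]
    × (∀ (a b : ℕ) → 2 ≤ b → (D : Fin (a + (b + 1)) → Fin (a + (b + 1)) → ℕ) →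
        IsDistanceMatrix (Λ a b) D →
        HasSmithNormalForm (toℤMatrix D) (snfDiag≥2 a b))
    -- b = 1 : SNF is I_{a+1} ⊕ [4a+1]
    × (∀ (a : ℕ) → (D : Fin (a + (1 + 1)) → Fin (a + (1 + 1)) → ℕ) →
        IsDistanceMatrix (Λ a 1) D →
        HasSmithNormalForm (toℤMatrix D) (snfDiag1 a))
theorem19 = distanceMatrix , smithNormalForm≥2 , OneW.smithNormalForm
  where
  distanceMatrix : ∀ a b → 1 ≤ b → Σ (Fin (a + (b + 1)) → Fin (a + (b + 1)) → ℕ) (IsDistanceMatrix (Λ a b))
  distanceMatrix a (suc b) _ = distance , distance-isDistanceMatrix zero
    where open Λ-structure a (suc b)
  smithNormalForm≥2 : ∀ a b → 2 ≤ b → ∀ D → IsDistanceMatrix (Λ a b) D → HasSmithNormalForm (toℤMatrix D) (snfDiag≥2 a b)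
  smithNormalForm≥2 a (suc (suc b′)) (s≤s (s≤s _)) = AtLeastTwoW.smithNormalForm a b′
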